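{- Let $a,b$ be positive integers, let $w_1$ be a positive integer and $w_0$ a nonnegative integer, and let $(w_n)_{n\ge 0}$ be defined by $w_n=a^{\zeta(n+1)}b^{\zeta(n)}w_{n-1}+w_{n-2}$ for $n\geq 2$, where $\zeta(n)=\frac{1-(-1)^n}{2}$. Then for every integer $n>1$, $$\sum_{k=1}^{n}\left(\frac{a}{b}\right)^{\zeta(k)}w_k^2=\frac{1}{b}\left(w_nw_{n+1}-w_0w_1\right).$$
   Context: $\zeta(n)=\frac{1-(-1)^n}{2}$ equals $0$ for even $n$ and $1$ for odd $n$. The sequence $(w_n)$ is called the generalized bi-periodic Fibonacci sequence. -}

module Defs where

open import Data.Nat using (ℕ; zero; suc; _+_; _*_; _^_)
open import Data.Rational using (ℚ; 1ℚ; 0ℚ) renaming (_*_ to _*ℚ_; _+_ to _+ℚ_)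

ζ : ℕ → ℕ
ζ zero = 0
ζ (suc zero) = 1
ζ (suc (suc n)) = ζ n

_^ℚ_ : ℚ → ℕ → ℚ
q ^ℚ zero = 1ℚ
q ^ℚ suc n = q *ℚ (q ^ℚ n)

w : (a b w₀ w₁ : ℕ) → ℕ → ℕ
w a b w₀ w₁ zero = w₀
w a b w₀ w₁ (suc zero) = w₁
w a b w₀ w₁ (suc (suc n)) =
  (a ^ ζ (suc (suc (suc n)))) * (b ^ ζ (suc (suc n))) * w a b w₀ w₁ (suc n)
  + w a b w₀ w₁ n

Σ₁ : ℕ → (ℕ → ℚ) → ℚ
Σ₁ zero f = 0ℚ
Σ₁ (suc n) f = Σ₁ n f +ℚ f (suc n)

-- Multiplying the recurrence for w (k+2) by w (k+1) gives
--   w (k+1) w (k+2) − w k w (k+1) = a^ζ(k+1) b^ζ(k) w (k+1)²,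
-- and a^ζ(k+1) b^ζ(k) is a for odd k+1 and b for even k+1, i.e. b (a/b)^ζ(k+1).
-- So each summand (a/b)^ζ(k) w k² is 1/b times the difference of the consecutive
-- products w k w (k+1) and w (k−1) w k, and the sum telescopes.  This holds for
-- every n.
{-# OPTIONS --safe #-}
module Submission where

open import Defs
open import Data.Nat using (ℕ; zero; suc; _<_; _^_; NonZero) renaming (_*_ to _*ℕ_; _+_ to _+ℕ_)
import Data.Nat.Properties as ℕ
open import Data.Nat.Tactic.RingSolver using (solve-∀)
open import Data.Integer using (+_) renaming (_*_ to _*ℤ_; _+_ to _+ℤ_)
import Data.Integer.Properties as ℤ
import Data.Integer.Tactic.RingSolver as ℤ-Solver
open import Data.Rational using (ℚ; _/_; _*_; _-_; _+_; 0ℚ; 1ℚ; toℚᵘ)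
open import Data.Rational.Properties using (toℚᵘ-injective; toℚᵘ-fromℚᵘ; toℚᵘ-homo-+; toℚᵘ-homo-*; *-comm)
open import Data.Rational.Solver using (module +-*-Solver)
import Data.Rational.Unnormalised as ℚᵘ
import Data.Rational.Unnormalised.Properties as ℚᵘ
open import Relation.Binary.PropositionalEquality

open +-*-Solver

fromℕ : ℕ → ℚ
fromℕ m = + m / 1

toℚᵘ-/ : ∀ m k → toℚᵘ (+ m / suc k) ℚᵘ.≃ ℚᵘ.mkℚᵘ (+ m) k
toℚᵘ-/ m k = toℚᵘ-fromℚᵘ (ℚᵘ.mkℚᵘ (+ m) k)

fromℕ-homo-+ : ∀ m n → fromℕ (m +ℕ n) ≡ fromℕ m + fromℕ n
fromℕ-homo-+ m n = toℚᵘ-injective (begin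
  toℚᵘ (fromℕ (m +ℕ n))              ≈⟨ toℚᵘ-/ (m +ℕ n) 0 ⟩
  ℚᵘ.mkℚᵘ (+ (m +ℕ n)) 0             ≈⟨ ℚᵘ.*≡* (trans (cong (_*ℤ (+ 1 *ℤ + 1)) (ℤ.pos-+ m n)) (identity (+ m) (+ n))) ⟩
  ℚᵘ.mkℚᵘ (+ m) 0 ℚᵘ.+ ℚᵘ.mkℚᵘ (+ n) 0 ≈⟨ ℚᵘ.+-cong (toℚᵘ-/ m 0) (toℚᵘ-/ n 0) ⟨
  toℚᵘ (fromℕ m) ℚᵘ.+ toℚᵘ (fromℕ n)  ≈⟨ toℚᵘ-homo-+ (fromℕ m) (fromℕ n) ⟨
  toℚᵘ (fromℕ m + fromℕ n)            ∎)
  where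
  open ℚᵘ.≃-Reasoning
  identity : ∀ x y → (x +ℤ y) *ℤ (+ 1 *ℤ + 1) ≡ (x *ℤ + 1 +ℤ y *ℤ + 1) *ℤ + 1
  identity = ℤ-Solver.solve-∀

fromℕ-homo-* : ∀ m n → fromℕ (m *ℕ n) ≡ fromℕ m * fromℕ n
fromℕ-homo-* m n = toℚᵘ-injective (begin
  toℚᵘ (fromℕ (m *ℕ n))              ≈⟨ toℚᵘ-/ (m *ℕ n) 0 ⟩
  ℚᵘ.mkℚᵘ (+ (m *ℕ n)) 0             ≈⟨ ℚᵘ.*≡* (trans (cong (_*ℤ (+ 1 *ℤ + 1)) (ℤ.pos-* m n)) (identity (+ m) (+ n))) ⟩
  ℚᵘ.mkℚᵘ (+ m) 0 ℚᵘ.* ℚᵘ.mkℚᵘ (+ n) 0 ≈⟨ ℚᵘ.*-cong (toℚᵘ-/ m 0) (toℚᵘ-/ n 0) ⟨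
  toℚᵘ (fromℕ m) ℚᵘ.* toℚᵘ (fromℕ n)  ≈⟨ toℚᵘ-homo-* (fromℕ m) (fromℕ n) ⟨
  toℚᵘ (fromℕ m * fromℕ n)            ∎)
  where
  open ℚᵘ.≃-Reasoning
  identity : ∀ x y → (x *ℤ y) *ℤ (+ 1 *ℤ + 1) ≡ (x *ℤ y) *ℤ + 1
  identity = ℤ-Solver.solve-∀

m/d≡1/d*m : ∀ m d .{{_ : NonZero d}} → + m / d ≡ (+ 1 / d) * fromℕ m
m/d≡1/d*m m (suc k) = toℚᵘ-injective (begin
  toℚᵘ (+ m / suc k)                      ≈⟨ toℚᵘ-/ m k ⟩
  ℚᵘ.mkℚᵘ (+ m) k                         ≈⟨ ℚᵘ.*≡* (identity (+ m) (+ suc k)) ⟩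
  ℚᵘ.mkℚᵘ (+ 1) k ℚᵘ.* ℚᵘ.mkℚᵘ (+ m) 0      ≈⟨ ℚᵘ.*-cong (toℚᵘ-/ 1 k) (toℚᵘ-/ m 0) ⟨
  toℚᵘ (+ 1 / suc k) ℚᵘ.* toℚᵘ (fromℕ m)   ≈⟨ toℚᵘ-homo-* (+ 1 / suc k) (fromℕ m) ⟨
  toℚᵘ ((+ 1 / suc k) * fromℕ m)           ∎)
  where
  open ℚᵘ.≃-Reasoning
  identity : ∀ x d → x *ℤ (d *ℤ + 1) ≡ (+ 1 *ℤ x) *ℤ d
  identity = ℤ-Solver.solve-∀

1/d*d≡1 : ∀ d .{{_ : NonZero d}} → (+ 1 / d) * fromℕ d ≡ 1ℚ
1/d*d≡1 d = trans (sym (m/d≡1/d*m d d)) (d/d≡1 d)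
  where
  d/d≡1 : ∀ d .{{_ : NonZero d}} → + d / d ≡ 1ℚ
  d/d≡1 (suc k) = toℚᵘ-injective (ℚᵘ.≃-trans (toℚᵘ-/ (suc k) k) (ℚᵘ.*≡* (ℤ.*-comm (+ suc k) (+ 1))))

Σ₁-telescope : (f P : ℕ → ℚ) (c : ℚ) → (∀ n → f (suc n) ≡ c * (P (suc n) - P n)) →
               ∀ n → Σ₁ n f ≡ c * (P n - P 0)
Σ₁-telescope f P c step zero = solve 2 (λ c p → con 0ℚ := c :* (p :- p)) refl c (P 0)
Σ₁-telescope f P c step (suc n) = begin
  Σ₁ n f + f (suc n)                          ≡⟨ cong₂ _+_ (Σ₁-telescope f P c step n) (step n) ⟩
  c * (P n - P 0) + c * (P (suc n) - P n)     ≡⟨ telescoping c (P n) (P 0) (P (suc n)) ⟩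
  c * (P (suc n) - P 0)                       ∎
  where
  open ≡-Reasoning
  telescoping : ∀ c p q r → c * (p - q) + c * (r - p) ≡ c * (r - q)
  telescoping = solve 4 (λ c p q r → c :* (p :- q) :+ c :* (r :- p) := c :* (r :- q)) refl

module _ (a b : ℕ) .{{_ : NonZero b}} where

  coefficient : ℕ → ℕ
  coefficient n = a ^ ζ (suc n) *ℕ b ^ ζ n

  weight-coefficient : ∀ n S → ((+ a / b) ^ℚ ζ (suc n)) * S ≡ (+ 1 / b) * (S * fromℕ (coefficient n))
  weight-coefficient zero S = begin
    ((+ a / b) * 1ℚ) * S                     ≡⟨ cong (λ t → (t * 1ℚ) * S) (m/d≡1/d*m a b) ⟩
    ((+ 1 / b) * fromℕ a * 1ℚ) * S           ≡⟨ reorder (+ 1 / b) (fromℕ a) S ⟩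
    (+ 1 / b) * (S * fromℕ a)                ≡⟨ cong (λ t → (+ 1 / b) * (S * fromℕ t)) (trans (ℕ.*-identityʳ (a *ℕ 1)) (ℕ.*-identityʳ a)) ⟨
    (+ 1 / b) * (S * fromℕ (a *ℕ 1 *ℕ 1))    ∎
    where
    open ≡-Reasoning
    reorder : ∀ x A S → (x * A * 1ℚ) * S ≡ x * (S * A)
    reorder = solve 3 (λ x A S → (x :* A :* con 1ℚ) :* S := x :* (S :* A)) refl
  weight-coefficient (suc zero) S = begin
    1ℚ * S                                   ≡⟨ *-comm 1ℚ S ⟩
    S * 1ℚ                                   ≡⟨ cong (S *_) (1/d*d≡1 b) ⟨
    S * ((+ 1 / b) * fromℕ b)                ≡⟨ reorder (+ 1 / b) (fromℕ b) S ⟩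
    (+ 1 / b) * (S * fromℕ b)                ≡⟨ cong (λ t → (+ 1 / b) * (S * fromℕ t)) (trans (ℕ.*-identityˡ (b *ℕ 1)) (ℕ.*-identityʳ b)) ⟨
    (+ 1 / b) * (S * fromℕ (1 *ℕ (b *ℕ 1)))  ∎
    where
    open ≡-Reasoning
    reorder : ∀ x B S → S * (x * B) ≡ x * (S * B)
    reorder = solve 3 (λ x B S → S :* (x :* B) := x :* (S :* B)) refl
  weight-coefficient (suc (suc n)) S = weight-coefficient n S

  module _ (w₀ w₁ : ℕ) where

    private
      W : ℕ → ℕ
      W = w a b w₀ w₁

    product : ℕ → ℚ
    product n = fromℕ (W n *ℕ W (suc n))

    product-step : ∀ n → W (suc n) *ℕ W (suc (suc n)) ≡ W (suc n) *ℕ W (suc n) *ℕ coefficient n +ℕ W n *ℕ W (suc n)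
    product-step n = expand (W (suc n)) (coefficient n) (W n)
      where
      expand : ∀ v c u → v *ℕ (c *ℕ v +ℕ u) ≡ v *ℕ v *ℕ c +ℕ u *ℕ v
      expand = solve-∀

    product-difference : ∀ n → product (suc n) - product n ≡ fromℕ (W (suc n) *ℕ W (suc n)) * fromℕ (coefficient n)
    product-difference n = begin
      product (suc n) - product n                      ≡⟨ cong (λ t → fromℕ t - product n) (product-step n) ⟩
      fromℕ (V² *ℕ coefficient n +ℕ W n *ℕ W (suc n)) - product n
                                                       ≡⟨ cong (_- product n) (fromℕ-homo-+ (V² *ℕ coefficient n) (W n *ℕ W (suc n))) ⟩
      fromℕ (V² *ℕ coefficient n) + product n - product n
                                                       ≡⟨ cancel (fromℕ (V² *ℕ coefficient n)) (product n) ⟩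
      fromℕ (V² *ℕ coefficient n)                      ≡⟨ fromℕ-homo-* V² (coefficient n) ⟩
      fromℕ V² * fromℕ (coefficient n)                 ∎
      where
      open ≡-Reasoning
      V² : ℕ
      V² = W (suc n) *ℕ W (suc n)
      cancel : ∀ x y → x + y - y ≡ x
      cancel = solve 2 (λ x y → x :+ y :- y := x) refl

    Σ₁-weighted-squares : ∀ n → Σ₁ n (λ k → ((+ a / b) ^ℚ ζ k) * fromℕ (W k *ℕ W k)) ≡ (+ 1 / b) * (product n - product 0)
    Σ₁-weighted-squares = Σ₁-telescope _ product (+ 1 / b) λ n →
      trans (weight-coefficient n (fromℕ (W (suc n) *ℕ W (suc n))))
            (cong ((+ 1 / b) *_) (sym (product-difference n)))

mainTheorem1 : (a b w₀ w₁ : ℕ) → 0 < a → .{{_ : NonZero b}} → 0 < w₁ →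
    (n : ℕ) → 1 < n →
    Σ₁ n (λ k → ((+ a / b) ^ℚ ζ k) * ((+ (w a b w₀ w₁ k *ℕ w a b w₀ w₁ k)) / 1))
    ≡ (+ 1 / b) * ((+ (w a b w₀ w₁ n *ℕ w a b w₀ w₁ (suc n))) / 1 - (+ (w₀ *ℕ w₁)) / 1)
mainTheorem1 a b w₀ w₁ _ _ n _ = Σ₁-weighted-squares a b w₀ w₁ n
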